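{- Let $G$ and $H$ be graphs with the same vertex set. The following are equivalent: (1) $H$ is a spanning subgraph of $G$ (i.e. $E(H)\subseteq E(G)$); (2) the convergence of $H$ is finer than that of $G$, i.e. for every net $\varphi$ in $V(H)=V(G)$ and every vertex $v$, if $\varphi$ converges to $v$ in $H$ then $\varphi$ converges to $v$ in $G$.
   Context: Graphs are simple and undirected. For a graph $K$ and $v\in V(K)$, $N_K[v]$ is the closed neighbourhood of $v$ in $K$. A net is a function $\varphi\colon\mathbb{D}\to V(K)$ from a directed set. Convergence in $K$: $\varphi$ converges to $v$ iff there is $d$ with $\{\varphi_b:b\ge d\}\subseteq N_K[v]$. -}

module Defs where

open import Level using (Level; suc; _⊔_; 0ℓ)
open import Data.Product using (Σ; _×_; _,_; ∃)
open import Data.Sum using (_⊎_)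
open import Relation.Binary.PropositionalEquality using (_≡_)
open import Relation.Nullary using (¬_)

record Graph (V : Set) : Set₁ where
  field
    Adj       : V → V → Set
    Adj-sym   : ∀ {u v} → Adj u v → Adj v u
    Adj-irrefl : ∀ {v} → ¬ Adj v v
open Graph public

SpanningSubgraph : {V : Set} → Graph V → Graph V → Set
SpanningSubgraph {V} H G = ∀ {u v : V} → Adj H u v → Adj G u v

ClosedNbhd : {V : Set} → Graph V → V → V → Set
ClosedNbhd K v w = (w ≡ v) ⊎ Adj K v w

record DirectedSet : Set₁ where
  field
    Carrier  : Set
    _≤_      : Carrier → Carrier → Set
    ≤-refl   : ∀ {a} → a ≤ a
    ≤-trans  : ∀ {a b c} → a ≤ b → b ≤ c → a ≤ c
    nonempty : Carrier
    upper    : ∀ a b → Σ Carrier λ c → (a ≤ c) × (b ≤ c)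
open DirectedSet public

Net : DirectedSet → Set → Set
Net D V = Carrier D → V

ConvergesTo : {V : Set} → Graph V → (D : DirectedSet) → Net D V → V → Set
ConvergesTo K D φ v = Σ (Carrier D) λ d → ∀ b → _≤_ D d b → ClosedNbhd K v (φ b)

FinerConvergence : {V : Set} → Graph V → Graph V → Set₁
FinerConvergence {V} H G =
  ∀ (D : DirectedSet) (φ : Net D V) (v : V) → ConvergesTo H D φ v → ConvergesTo G D φ v

{-# OPTIONS --safe #-}
module Submission where

open import Defs
open import Data.Product using (_×_; _,_)
open import Data.Sum using (inj₁; inj₂; map₂)
open import Data.Unit using (⊤; tt)
open import Data.Empty using (⊥-elim)
open import Function using (const)
open import Relation.Binary.PropositionalEquality using (_≢_; refl)

-- Closed neighbourhoods only grow when edges are added, so eventual membership in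
-- N_H[v] implies eventual membership in N_G[v]. Conversely, an edge uv of H makes
-- the constant net v converge to u in H, hence in G; since v ≠ u by irreflexivity,
-- uv must be an edge of G.

module _ {V : Set} {H G : Graph V} where

  ClosedNbhd-mono : SpanningSubgraph H G → ∀ {v w} → ClosedNbhd H v w → ClosedNbhd G v w
  ClosedNbhd-mono H⊆G = map₂ H⊆G

  spanningSubgraph⇒finerConvergence : SpanningSubgraph H G → FinerConvergence H G
  spanningSubgraph⇒finerConvergence H⊆G D φ v (d , eventually) =
    d , λ b d≤b → ClosedNbhd-mono H⊆G (eventually b d≤b)

module _ {V : Set} (K : Graph V) (D : DirectedSet) where

  const-convergesTo : ∀ {v w} → ClosedNbhd K v w → ConvergesTo K D (const w) v
  const-convergesTo w∈N[v] = nonempty D , λ _ _ → w∈N[v]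

  const-convergesTo⇒ClosedNbhd : ∀ {v w} → ConvergesTo K D (const w) v → ClosedNbhd K v w
  const-convergesTo⇒ClosedNbhd (d , eventually) = eventually d (≤-refl D)

Adj⇒≢ : {V : Set} (K : Graph V) → ∀ {u v} → Adj K u v → v ≢ u
Adj⇒≢ K uv refl = Adj-irrefl K uv

ClosedNbhd⇒Adj : {V : Set} (K : Graph V) → ∀ {v w} → w ≢ v → ClosedNbhd K v w → Adj K v w
ClosedNbhd⇒Adj K w≢v (inj₁ w≡v) = ⊥-elim (w≢v w≡v)
ClosedNbhd⇒Adj K w≢v (inj₂ vw)  = vw

⊤-directedSet : DirectedSet
⊤-directedSet = record
  { Carrier  = ⊤
  ; _≤_      = λ _ _ → ⊤
  ; ≤-refl   = tt
  ; ≤-trans  = λ _ _ → tt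
  ; nonempty = tt
  ; upper    = λ _ _ → tt , tt , tt
  }

finerConvergence⇒spanningSubgraph : {V : Set} {H G : Graph V} →
                                    FinerConvergence H G → SpanningSubgraph H G
finerConvergence⇒spanningSubgraph {H = H} {G} finer {u} {v} uv =
  ClosedNbhd⇒Adj G (Adj⇒≢ H uv)
    (const-convergesTo⇒ClosedNbhd G ⊤-directedSet
      (finer ⊤-directedSet (const v) u (const-convergesTo H ⊤-directedSet (inj₂ uv))))

mainTheorem6 : {V : Set} (G H : Graph V) →
    (SpanningSubgraph H G → FinerConvergence H G) × (FinerConvergence H G → SpanningSubgraph H G)
mainTheorem6 G H =
  spanningSubgraph⇒finerConvergence {H = H} {G} , finerConvergence⇒spanningSubgraph {H = H} {G}
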